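{- Let $\mathbf{p}(x)\in\mathbb{Z}[x]$ be a monic irreducible polynomial of degree $3$, and let $\theta\in\mathbb{C}$ be a root of $\mathbf{p}$. Let $\square_2(\theta)=\{w_1^2+w_2^2:\ w_1,w_2\in\mathbb{Z}[\theta]\}$. If an integer $z\in\mathbb{Z}$ satisfies $q^2(z-\theta)\in\square_2(\theta)$ for some $q\in\mathbb{N}$, then $\mathbf{p}(z)$ is a sum of two squares of integers. -}

module Defs where

open import Data.Nat using (ℕ; zero; suc)
open import Data.Integer using (ℤ; +_; -_; _+_; _*_)
open import Data.List using (List; []; _∷_; map)
open import Data.Product using (Σ; ∃; _×_; _,_)
open import Data.Sum using (_⊎_)
open import Relation.Nullary using (¬_)
open import Relation.Binary.PropositionalEquality using (_≡_)

-- Polynomials in ℤ[x] as coefficient lists, lowest degree first: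
-- [a₀, a₁, …, aₙ] represents a₀ + a₁ x + … + aₙ xⁿ.
Poly : Set
Poly = List ℤ

coeff : Poly → ℕ → ℤ
coeff []       _       = + 0
coeff (a ∷ f)  zero    = a
coeff (a ∷ f)  (suc n) = coeff f n

-- Equality of polynomials: all coefficients agree (ignores trailing zeros).
infix 4 _≈ₚ_
_≈ₚ_ : Poly → Poly → Set
f ≈ₚ g = ∀ n → coeff f n ≡ coeff g n

infixl 6 _+ₚ_
_+ₚ_ : Poly → Poly → Poly
[]      +ₚ g       = g
(a ∷ f) +ₚ []      = a ∷ f
(a ∷ f) +ₚ (b ∷ g) = (a + b) ∷ (f +ₚ g)

infixl 7 _*ₚ_
_*ₚ_ : Poly → Poly → Poly
[]      *ₚ g = []
(a ∷ f) *ₚ g = map (a *_) g +ₚ (+ 0 ∷ (f *ₚ g))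

const : ℤ → Poly
const a = a ∷ []

X : Poly
X = + 0 ∷ + 1 ∷ []

eval : Poly → ℤ → ℤ
eval []      z = + 0
eval (a ∷ f) z = a + z * eval f z

IsUnit : Poly → Set
IsUnit f = ∃ λ g → f *ₚ g ≈ₚ const (+ 1)

Irreducible : Poly → Set
Irreducible p = ¬ IsUnit p × (∀ f g → p ≈ₚ f *ₚ g → IsUnit f ⊎ IsUnit g)

monicCubic : ℤ → ℤ → ℤ → Poly
monicCubic a b c = c ∷ b ∷ a ∷ + 1 ∷ []

-- ℤ[θ] ≅ ℤ[x]/(p) for θ a root of the monic irreducible p.
-- "u ∈ □₂(θ)": u(θ) = w₁(θ)² + w₂(θ)² for some w₁, w₂ ∈ ℤ[θ],
-- i.e. u ≡ w₁² + w₂² modulo p in ℤ[x].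
InSumTwoSquares : Poly → Poly → Set
InSumTwoSquares p u =
  Σ Poly λ w₁ → Σ Poly λ w₂ → Σ Poly λ h →
    u ≈ₚ w₁ *ₚ w₁ +ₚ w₂ *ₚ w₂ +ₚ p *ₚ h

{-# OPTIONS --safe #-}
module Submission where

-- Reduce modulo p: in ℤ[θ] = ℤ[x]/(p) the hypothesis reads q²(z − θ) = U² + V². Take norms.
-- On the left, N(q²(z − θ)) = q⁶ p(z), since the norm is cubic and z − θ has characteristic
-- polynomial p. On the right, U² + V² = (U + iV)(U − iV) in ℤ[i][θ], so its norm is
-- N(U + iV) times its conjugate, a sum of two integer squares. Hence p(z) (q³)² is a sum of two
-- squares, and the Davenport–Cassels descent (if n d² is a sum of two squares, so is n)
-- removes the factor (q³)².

open import Defs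
open import Level using (0ℓ)
open import Algebra.Bundles.Raw using (RawRing)
open import Data.Nat as ℕ using (ℕ; zero; suc)
open import Data.Integer using (ℤ; +_; -[1+_]; 0ℤ; 1ℤ; +-*-rawRing)
open import Data.List using (List; []; _∷_; map)
open import Data.Product using (Σ; _×_; _,_; proj₁; proj₂)
open import Data.Product.Relation.Binary.Pointwise.NonDependent using (Pointwise)
open import Data.Vec using (Vec; []; _∷_)
open import Data.Vec.N-ary using (N-ary)
open import Function using (_∘_)
open import Relation.Binary.PropositionalEquality
  using (_≡_; refl; sym; trans; cong; cong₂; subst; module ≡-Reasoning)
import Data.Integer.Tactic.RingSolver as ℤ-Solver
open import Tactic.RingSolver.NonReflective ℤ-Solver.ring
  using (Expr; Κ; _⊕_; _⊗_; ⊝_; solve; _⊜_; module Ops)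

-- u₀ + u₁ θ + u₂ θ², in the basis 1, θ, θ² of R[x]/(x³ + a x² + b x + c).
record Cubic (A : Set) : Set where
  constructor ⟨_,_,_⟩
  field
    x₀ x₁ x₂ : A
open Cubic

⟨⟩-cong : {A : Set} {u₀ u₁ u₂ v₀ v₁ v₂ : A} →
          u₀ ≡ v₀ → u₁ ≡ v₁ → u₂ ≡ v₂ → ⟨ u₀ , u₁ , u₂ ⟩ ≡ ⟨ v₀ , v₁ , v₂ ⟩
⟨⟩-cong refl refl refl = refl

mapCubic : {A B : Set} → (A → B) → Cubic A → Cubic B
mapCubic f ⟨ u₀ , u₁ , u₂ ⟩ = ⟨ f u₀ , f u₁ , f u₂ ⟩

module CubicExtension (R : RawRing 0ℓ 0ℓ) (a b c : RawRing.Carrier R) where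
  open RawRing R

  ι : Carrier → Cubic Carrier
  ι k = ⟨ k , 0# , 0# ⟩

  infixl 6 _⊞_
  _⊞_ : Cubic Carrier → Cubic Carrier → Cubic Carrier
  ⟨ u₀ , u₁ , u₂ ⟩ ⊞ ⟨ v₀ , v₁ , v₂ ⟩ = ⟨ u₀ + v₀ , u₁ + v₁ , u₂ + v₂ ⟩

  infixr 7 _•_
  _•_ : Carrier → Cubic Carrier → Cubic Carrier
  k • u = mapCubic (k *_) u

  -- multiplication by θ, using θ³ = − c − b θ − a θ²
  θ* : Cubic Carrier → Cubic Carrier
  θ* ⟨ u₀ , u₁ , u₂ ⟩ = ⟨ - (c * u₂) , u₀ + - (b * u₂) , u₁ + - (a * u₂) ⟩

  infixl 7 _⊠_
  _⊠_ : Cubic Carrier → Cubic Carrier → Cubic Carrier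
  ⟨ u₀ , u₁ , u₂ ⟩ ⊠ v = u₀ • v ⊞ θ* (u₁ • v ⊞ θ* (u₂ • v))

  ⟦_⟧ : List Carrier → Cubic Carrier
  ⟦ [] ⟧    = ι 0#
  ⟦ k ∷ f ⟧ = ι k ⊞ θ* ⟦ f ⟧

  det : Cubic Carrier → Cubic Carrier → Cubic Carrier → Carrier
  det ⟨ u₀ , u₁ , u₂ ⟩ ⟨ v₀ , v₁ , v₂ ⟩ ⟨ w₀ , w₁ , w₂ ⟩ =
    u₀ * (v₁ * w₂ + - (v₂ * w₁)) + - (v₀ * (u₁ * w₂ + - (u₂ * w₁))) + w₀ * (u₁ * v₂ + - (u₂ * v₁))

  -- the determinant of multiplication by u, whose columns are u, θ u and θ² u
  norm : Cubic Carrier → Carrier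
  norm u = det u (θ* u) (θ* (θ* u))

gaussian : RawRing 0ℓ 0ℓ → RawRing 0ℓ 0ℓ
gaussian R = record
  { Carrier = Carrier × Carrier
  ; _≈_     = Pointwise _≈_ _≈_
  ; _+_     = λ (x , y) (x′ , y′) → x + x′ , y + y′
  ; _*_     = λ (x , y) (x′ , y′) → x * x′ + - (y * y′) , x * y′ + y * x′
  ; -_      = λ (x , y) → - x , - y
  ; 0#      = 0# , 0#
  ; 1#      = 1# , 0#
  }
  where open RawRing R

-- The arithmetic above is generic in the raw ring so that, instantiated at the solver's
-- expressions, identities in ℤ[θ] can be checked by normalisation, one coordinate at a time.
exprRawRing : ℕ → RawRing 0ℓ 0ℓ
exprRawRing n = record
  { Carrier = Expr ℤ n
  ; _≈_     = _≡_
  ; _+_     = _⊕_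
  ; _*_     = _⊗_
  ; -_      = ⊝_
  ; 0#      = Κ 0ℤ
  ; 1#      = Κ 1ℤ
  }

module Symbolic {n : ℕ} (a b c : Expr ℤ n) = CubicExtension (exprRawRing n) a b c

prove³ : ∀ n (f : N-ary n (Expr ℤ n) (Cubic (Expr ℤ n) × Cubic (Expr ℤ n))) (ρ : Vec ℤ n) →
         let (lhs , rhs) = Ops.close n f in
         Ops.⟦ x₀ lhs ⇓⟧ ρ ≡ Ops.⟦ x₀ rhs ⇓⟧ ρ → Ops.⟦ x₁ lhs ⇓⟧ ρ ≡ Ops.⟦ x₁ rhs ⇓⟧ ρ →
         Ops.⟦ x₂ lhs ⇓⟧ ρ ≡ Ops.⟦ x₂ rhs ⇓⟧ ρ →
         mapCubic (λ e → Ops.⟦ e ⟧ ρ) lhs ≡ mapCubic (λ e → Ops.⟦ e ⟧ ρ) rhs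
prove³ n f ρ eq₀ eq₁ eq₂ =
  ⟨⟩-cong (Ops.prove ρ (x₀ lhs) (x₀ rhs) eq₀) (Ops.prove ρ (x₁ lhs) (x₁ rhs) eq₁)
          (Ops.prove ρ (x₂ lhs) (x₂ rhs) eq₂)
  where
  lhs = proj₁ (Ops.close n f)
  rhs = proj₂ (Ops.close n f)

module IntegralCubic (a b c : ℤ) where
  open import Data.Integer using (_+_; _*_; -_)
  open import Data.Integer.Properties using (+-identityˡ; +-identityʳ; *-zeroʳ; pos-*)
  open import Data.Integer.Tactic.RingSolver using (solve-∀)
  open CubicExtension +-*-rawRing a b c public

  ⊞-identityˡ : ∀ F → ι 0ℤ ⊞ F ≡ F
  ⊞-identityˡ F = ⟨⟩-cong (+-identityˡ (x₀ F)) (+-identityˡ (x₁ F)) (+-identityˡ (x₂ F))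

  ⊞-identityʳ : ∀ F → F ⊞ ι 0ℤ ≡ F
  ⊞-identityʳ F = ⟨⟩-cong (+-identityʳ (x₀ F)) (+-identityʳ (x₁ F)) (+-identityʳ (x₂ F))

  •-zeroʳ : ∀ k → k • ι 0ℤ ≡ ι 0ℤ
  •-zeroʳ k = ⟨⟩-cong (*-zeroʳ k) (*-zeroʳ k) (*-zeroʳ k)

  ⊠-zeroˡ : ∀ G → ι 0ℤ ⊠ G ≡ ι 0ℤ
  ⊠-zeroˡ G = prove³ 6
    (λ a b c g₀ g₁ g₂ → let module E = Symbolic a b c in E.ι (Κ 0ℤ) E.⊠ ⟨ g₀ , g₁ , g₂ ⟩ , E.ι (Κ 0ℤ))
    (a ∷ b ∷ c ∷ x₀ G ∷ x₁ G ∷ x₂ G ∷ []) refl refl refl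

  ⟦⟧-+ : ∀ f g → ⟦ f +ₚ g ⟧ ≡ ⟦ f ⟧ ⊞ ⟦ g ⟧
  ⟦⟧-+ []      g       = sym (⊞-identityˡ ⟦ g ⟧)
  ⟦⟧-+ (k ∷ f) []      = sym (⊞-identityʳ ⟦ k ∷ f ⟧)
  ⟦⟧-+ (k ∷ f) (l ∷ g) =
    trans (cong (λ H → ι (k + l) ⊞ θ* H) (⟦⟧-+ f g)) (horner-step k l ⟦ f ⟧ ⟦ g ⟧)
    where
    horner-step : ∀ k l F G → ι (k + l) ⊞ θ* (F ⊞ G) ≡ (ι k ⊞ θ* F) ⊞ (ι l ⊞ θ* G)
    horner-step k l F G = prove³ 11
      (λ a b c k l f₀ f₁ f₂ g₀ g₁ g₂ →
        let module E = Symbolic a b c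
            F = ⟨ f₀ , f₁ , f₂ ⟩
            G = ⟨ g₀ , g₁ , g₂ ⟩
        in E.ι (k ⊕ l) E.⊞ E.θ* (F E.⊞ G) , (E.ι k E.⊞ E.θ* F) E.⊞ (E.ι l E.⊞ E.θ* G))
      (a ∷ b ∷ c ∷ k ∷ l ∷ x₀ F ∷ x₁ F ∷ x₂ F ∷ x₀ G ∷ x₁ G ∷ x₂ G ∷ []) refl refl refl

  ⟦⟧-• : ∀ k g → ⟦ map (k *_) g ⟧ ≡ k • ⟦ g ⟧
  ⟦⟧-• k []      = sym (•-zeroʳ k)
  ⟦⟧-• k (l ∷ g) =
    trans (cong (λ H → ι (k * l) ⊞ θ* H) (⟦⟧-• k g)) (horner-step l ⟦ g ⟧)
    where
    horner-step : ∀ l G → ι (k * l) ⊞ θ* (k • G) ≡ k • (ι l ⊞ θ* G)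
    horner-step l G = prove³ 8
      (λ a b c k l g₀ g₁ g₂ →
        let module E = Symbolic a b c
            G = ⟨ g₀ , g₁ , g₂ ⟩
        in E.ι (k ⊗ l) E.⊞ E.θ* (k E.• G) , k E.• (E.ι l E.⊞ E.θ* G))
      (a ∷ b ∷ c ∷ k ∷ l ∷ x₀ G ∷ x₁ G ∷ x₂ G ∷ []) refl refl refl

  ⟦⟧-* : ∀ f g → ⟦ f *ₚ g ⟧ ≡ ⟦ f ⟧ ⊠ ⟦ g ⟧
  ⟦⟧-* []      g = sym (⊠-zeroˡ ⟦ g ⟧)
  ⟦⟧-* (k ∷ f) g = begin
    ⟦ map (k *_) g +ₚ (0ℤ ∷ f *ₚ g) ⟧        ≡⟨ ⟦⟧-+ (map (k *_) g) (0ℤ ∷ f *ₚ g) ⟩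
    ⟦ map (k *_) g ⟧ ⊞ (ι 0ℤ ⊞ θ* ⟦ f *ₚ g ⟧)
      ≡⟨ cong₂ (λ H I → H ⊞ (ι 0ℤ ⊞ θ* I)) (⟦⟧-• k g) (⟦⟧-* f g) ⟩
    k • ⟦ g ⟧ ⊞ (ι 0ℤ ⊞ θ* (⟦ f ⟧ ⊠ ⟦ g ⟧))  ≡⟨ horner-step ⟦ f ⟧ ⟦ g ⟧ ⟩
    (ι k ⊞ θ* ⟦ f ⟧) ⊠ ⟦ g ⟧                 ∎
    where
    open ≡-Reasoning
    horner-step : ∀ F G → k • G ⊞ (ι 0ℤ ⊞ θ* (F ⊠ G)) ≡ (ι k ⊞ θ* F) ⊠ G
    horner-step F G = prove³ 10
      (λ a b c k f₀ f₁ f₂ g₀ g₁ g₂ →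
        let module E = Symbolic a b c
            F = ⟨ f₀ , f₁ , f₂ ⟩
            G = ⟨ g₀ , g₁ , g₂ ⟩
        in k E.• G E.⊞ (E.ι (Κ 0ℤ) E.⊞ E.θ* (F E.⊠ G)) , (E.ι k E.⊞ E.θ* F) E.⊠ G)
      (a ∷ b ∷ c ∷ k ∷ x₀ F ∷ x₁ F ∷ x₂ F ∷ x₀ G ∷ x₁ G ∷ x₂ G ∷ []) refl refl refl

  ⟦⟧-zero : ∀ f → f ≈ₚ [] → ⟦ f ⟧ ≡ ι 0ℤ
  ⟦⟧-zero []      _   = refl
  ⟦⟧-zero (k ∷ f) f≈0 =
    trans (cong₂ (λ l H → ι l ⊞ θ* H) (f≈0 0) (⟦⟧-zero f (f≈0 ∘ suc))) horner-step
    where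
    horner-step : ι 0ℤ ⊞ θ* (ι 0ℤ) ≡ ι 0ℤ
    horner-step = prove³ 3
      (λ a b c → let module E = Symbolic a b c in E.ι (Κ 0ℤ) E.⊞ E.θ* (E.ι (Κ 0ℤ)) , E.ι (Κ 0ℤ))
      (a ∷ b ∷ c ∷ []) refl refl refl

  ⟦⟧-cong : ∀ f g → f ≈ₚ g → ⟦ f ⟧ ≡ ⟦ g ⟧
  ⟦⟧-cong []      []      _   = refl
  ⟦⟧-cong []      (l ∷ g) f≈g = sym (⟦⟧-zero (l ∷ g) (sym ∘ f≈g))
  ⟦⟧-cong (k ∷ f) []      f≈g = ⟦⟧-zero (k ∷ f) f≈g
  ⟦⟧-cong (k ∷ f) (l ∷ g) f≈g = cong₂ (λ m H → ι m ⊞ θ* H) (f≈g 0) (⟦⟧-cong f g (f≈g ∘ suc))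

  ⟦p⟧≡0 : ⟦ monicCubic a b c ⟧ ≡ ι 0ℤ
  ⟦p⟧≡0 = prove³ 3
    (λ a b c → let module E = Symbolic a b c in E.⟦ c ∷ b ∷ a ∷ Κ 1ℤ ∷ [] ⟧ , E.ι (Κ 0ℤ))
    (a ∷ b ∷ c ∷ []) refl refl refl

  ⟦⟧-mod-p : ∀ f w₁ w₂ h → f ≈ₚ w₁ *ₚ w₁ +ₚ w₂ *ₚ w₂ +ₚ monicCubic a b c *ₚ h →
             ⟦ f ⟧ ≡ ⟦ w₁ ⟧ ⊠ ⟦ w₁ ⟧ ⊞ ⟦ w₂ ⟧ ⊠ ⟦ w₂ ⟧
  ⟦⟧-mod-p f w₁ w₂ h f≈ = begin
    ⟦ f ⟧                                ≡⟨ ⟦⟧-cong f (w₁ *ₚ w₁ +ₚ w₂ *ₚ w₂ +ₚ p *ₚ h) f≈ ⟩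
    ⟦ w₁ *ₚ w₁ +ₚ w₂ *ₚ w₂ +ₚ p *ₚ h ⟧   ≡⟨ ⟦⟧-+ (w₁ *ₚ w₁ +ₚ w₂ *ₚ w₂) (p *ₚ h) ⟩
    ⟦ w₁ *ₚ w₁ +ₚ w₂ *ₚ w₂ ⟧ ⊞ ⟦ p *ₚ h ⟧
      ≡⟨ cong₂ _⊞_ (⟦⟧-+ (w₁ *ₚ w₁) (w₂ *ₚ w₂)) (⟦⟧-* p h) ⟩
    ⟦ w₁ *ₚ w₁ ⟧ ⊞ ⟦ w₂ *ₚ w₂ ⟧ ⊞ ⟦ p ⟧ ⊠ ⟦ h ⟧
      ≡⟨ cong₂ (λ S P → S ⊞ P ⊠ ⟦ h ⟧) (cong₂ _⊞_ (⟦⟧-* w₁ w₁) (⟦⟧-* w₂ w₂)) ⟦p⟧≡0 ⟩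
    U² ⊞ V² ⊞ ι 0ℤ ⊠ ⟦ h ⟧               ≡⟨ cong (U² ⊞ V² ⊞_) (⊠-zeroˡ ⟦ h ⟧) ⟩
    U² ⊞ V² ⊞ ι 0ℤ                       ≡⟨ ⊞-identityʳ (U² ⊞ V²) ⟩
    U² ⊞ V²                              ∎
    where
    open ≡-Reasoning
    p  = monicCubic a b c
    U² = ⟦ w₁ ⟧ ⊠ ⟦ w₁ ⟧
    V² = ⟦ w₂ ⟧ ⊠ ⟦ w₂ ⟧

  ⟦Q[z-x]⟧ : ∀ Q z → ⟦ const Q *ₚ (const z +ₚ const (- (+ 1)) *ₚ X) ⟧ ≡ Q • ⟨ z , - (+ 1) , 0ℤ ⟩
  ⟦Q[z-x]⟧ Q z = begin
    ⟦ const Q *ₚ (const z +ₚ minus-one *ₚ X) ⟧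
      ≡⟨ ⟦⟧-* (const Q) (const z +ₚ minus-one *ₚ X) ⟩
    ⟦ const Q ⟧ ⊠ ⟦ const z +ₚ minus-one *ₚ X ⟧
      ≡⟨ cong (⟦ const Q ⟧ ⊠_) (⟦⟧-+ (const z) (minus-one *ₚ X)) ⟩
    ⟦ const Q ⟧ ⊠ (⟦ const z ⟧ ⊞ ⟦ minus-one *ₚ X ⟧)
      ≡⟨ cong (λ H → ⟦ const Q ⟧ ⊠ (⟦ const z ⟧ ⊞ H)) (⟦⟧-* minus-one X) ⟩
    ⟦ const Q ⟧ ⊠ (⟦ const z ⟧ ⊞ ⟦ minus-one ⟧ ⊠ ⟦ X ⟧)
      ≡⟨ evaluate ⟩
    Q • ⟨ z , - (+ 1) , 0ℤ ⟩
      ∎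
    where
    open ≡-Reasoning
    minus-one = const (- (+ 1))
    evaluate : ⟦ const Q ⟧ ⊠ (⟦ const z ⟧ ⊞ ⟦ minus-one ⟧ ⊠ ⟦ X ⟧) ≡ Q • ⟨ z , - (+ 1) , 0ℤ ⟩
    evaluate = prove³ 5
      (λ a b c Q z → let module E = Symbolic a b c in
        E.⟦ Q ∷ [] ⟧ E.⊠ (E.⟦ z ∷ [] ⟧ E.⊞ E.⟦ ⊝ Κ 1ℤ ∷ [] ⟧ E.⊠ E.⟦ Κ 0ℤ ∷ Κ 1ℤ ∷ [] ⟧) ,
        Q E.• ⟨ z , ⊝ Κ 1ℤ , Κ 0ℤ ⟩)
      (a ∷ b ∷ c ∷ Q ∷ z ∷ []) refl refl refl

  norm-• : ∀ k u → norm (k • u) ≡ k * k * k * norm u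
  norm-• k u = solve 7
    (λ a b c k u₀ u₁ u₂ → let module E = Symbolic a b c in
      E.norm (k E.• ⟨ u₀ , u₁ , u₂ ⟩) ⊜ k ⊗ k ⊗ k ⊗ E.norm ⟨ u₀ , u₁ , u₂ ⟩)
    refl a b c k (x₀ u) (x₁ u) (x₂ u)

  norm[z-θ] : ∀ z → norm ⟨ z , - (+ 1) , 0ℤ ⟩ ≡ eval (monicCubic a b c) z
  norm[z-θ] z = solve 4
    (λ a b c z → let module E = Symbolic a b c in
      E.norm ⟨ z , ⊝ Κ 1ℤ , Κ 0ℤ ⟩ ⊜ (c ⊕ z ⊗ (b ⊕ z ⊗ (a ⊕ z ⊗ (Κ 1ℤ ⊕ z ⊗ Κ 0ℤ)))))
    refl a b c z

  norm-⟦Q[z-x]⟧ : ∀ Q z → norm ⟦ const Q *ₚ (const z +ₚ const (- (+ 1)) *ₚ X) ⟧ ≡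
                          Q * Q * Q * eval (monicCubic a b c) z
  norm-⟦Q[z-x]⟧ Q z = begin
    norm ⟦ const Q *ₚ (const z +ₚ const (- (+ 1)) *ₚ X) ⟧ ≡⟨ cong norm (⟦Q[z-x]⟧ Q z) ⟩
    norm (Q • ⟨ z , - (+ 1) , 0ℤ ⟩)                       ≡⟨ norm-• Q ⟨ z , - (+ 1) , 0ℤ ⟩ ⟩
    Q * Q * Q * norm ⟨ z , - (+ 1) , 0ℤ ⟩                 ≡⟨ cong (Q * Q * Q *_) (norm[z-θ] z) ⟩
    Q * Q * Q * eval (monicCubic a b c) z                 ∎
    where open ≡-Reasoning

  norm-⟦q²[z-x]⟧ : ∀ q z → norm ⟦ const (+ (q ℕ.* q)) *ₚ (const z +ₚ const (- (+ 1)) *ₚ X) ⟧ ≡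
                           eval (monicCubic a b c) z * (+ (q ℕ.* q ℕ.* q) * + (q ℕ.* q ℕ.* q))
  norm-⟦q²[z-x]⟧ q z =
    trans (norm-⟦Q[z-x]⟧ (+ (q ℕ.* q)) z) (cube-of-square (eval (monicCubic a b c) z))
    where
    open ≡-Reasoning
    q³ : + (q ℕ.* q ℕ.* q) ≡ + q * + q * + q
    q³ = trans (pos-* (q ℕ.* q) q) (cong (_* + q) (pos-* q q))
    sixth-power : ∀ t n → t * t * (t * t) * (t * t) * n ≡ n * (t * t * t * (t * t * t))
    sixth-power = solve-∀
    cube-of-square : ∀ n →
      + (q ℕ.* q) * + (q ℕ.* q) * + (q ℕ.* q) * n ≡ n * (+ (q ℕ.* q ℕ.* q) * + (q ℕ.* q ℕ.* q))
    cube-of-square n = begin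
      + (q ℕ.* q) * + (q ℕ.* q) * + (q ℕ.* q) * n ≡⟨ cong (λ t → t * t * t * n) (pos-* q q) ⟩
      + q * + q * (+ q * + q) * (+ q * + q) * n   ≡⟨ sixth-power (+ q) n ⟩
      n * (+ q * + q * + q * (+ q * + q * + q))   ≡⟨ cong (λ t → n * (t * t)) q³ ⟨
      n * (+ (q ℕ.* q ℕ.* q) * + (q ℕ.* q ℕ.* q)) ∎

  module GaussianCubic = CubicExtension (gaussian +-*-rawRing) (a , 0ℤ) (b , 0ℤ) (c , 0ℤ)

  _+i_ : Cubic ℤ → Cubic ℤ → Cubic (ℤ × ℤ)
  u +i v = ⟨ (x₀ u , x₀ v) , (x₁ u , x₁ v) , (x₂ u , x₂ v) ⟩

  -- U² + V² = (U + iV)(U − iV), and the norm of U − iV is the conjugate of that of U + iV.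
  norm-sum-of-squares : ∀ u v → let (r , s) = GaussianCubic.norm (u +i v) in
                        norm (u ⊠ u ⊞ v ⊠ v) ≡ r * r + s * s
  norm-sum-of-squares u v = solve 9
    (λ a b c u₀ u₁ u₂ v₀ v₁ v₂ →
      let module E = Symbolic a b c
          module G = CubicExtension (gaussian (exprRawRing 9)) (a , Κ 0ℤ) (b , Κ 0ℤ) (c , Κ 0ℤ)
          u = ⟨ u₀ , u₁ , u₂ ⟩
          v = ⟨ v₀ , v₁ , v₂ ⟩
          (r , s) = G.norm ⟨ (u₀ , v₀) , (u₁ , v₁) , (u₂ , v₂) ⟩
      in E.norm (u E.⊠ u E.⊞ v E.⊠ v) ⊜ (r ⊗ r ⊕ s ⊗ s))
    refl a b c (x₀ u) (x₁ u) (x₂ u) (x₀ v) (x₁ v) (x₂ v)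

module SumsOfTwoSquares where
  import Data.Nat.Properties as ℕ
  open import Data.Nat.Induction using (<-wellFounded)
  import Data.Nat.Tactic.RingSolver as ℕ-Solver
  open import Data.Integer using (_+_; _*_; _-_; _⊖_; ∣_∣)
  open import Data.Integer.Properties
    using (i≡j⇒i-j≡0; i-j≡0⇒i≡j; pos-+; pos-*; abs-*; +-injective; ∣i∣≡0⇒i≡0; *-cancelˡ-≡; *-comm;
           i*j≢0; +-identityʳ; *-zeroʳ; m-n≡m⊖n; ∣⊖∣-≤; ∣m⊖n∣≡∣n⊖m∣)
  open import Data.Integer.DivMod using (_/ℕ_; _%ℕ_; a≡a%ℕn+[a/ℕn]*n; n%ℕd<d)
  open import Data.Integer.Tactic.RingSolver using (solve-∀)
  open import Data.Sum using (_⊎_; inj₁; inj₂)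
  open import Induction.WellFounded using (Acc; acc)

  SumOfTwoSquares : ℤ → Set
  SumOfTwoSquares n = Σ ℤ λ m → Σ ℤ λ k → n ≡ m * m + k * k

  SumOfTwoRationalSquares : ℤ → ℕ → Set
  SumOfTwoRationalSquares n d = Σ ℤ λ y₁ → Σ ℤ λ y₂ → y₁ * y₁ + y₂ * y₂ ≡ n * (+ d * + d)

  i*i≡∣i∣*∣i∣ : ∀ i → i * i ≡ + (∣ i ∣ ℕ.* ∣ i ∣)
  i*i≡∣i∣*∣i∣ (+ n)    = sym (pos-* n n)
  i*i≡∣i∣*∣i∣ -[1+ n ] = refl

  m*m+n*n≡0⇒m≡0×n≡0 : ∀ m n → m ℕ.* m ℕ.+ n ℕ.* n ≡ 0 → m ≡ 0 × n ≡ 0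
  m*m+n*n≡0⇒m≡0×n≡0 zero    zero    _  = refl , refl
  m*m+n*n≡0⇒m≡0×n≡0 zero    (suc n) ()
  m*m+n*n≡0⇒m≡0×n≡0 (suc m) _       ()

  ∣m⊖n∣≤n : ∀ {m n} → m ℕ.≤ 2 ℕ.* n → ∣ m ⊖ n ∣ ℕ.≤ n
  ∣m⊖n∣≤n {m} {n} m≤2n with ℕ.≤-total m n
  ... | inj₁ m≤n = ℕ.≤-trans (ℕ.≤-reflexive (∣⊖∣-≤ m≤n)) (ℕ.m∸n≤m n m)
  ... | inj₂ n≤m = begin
    ∣ m ⊖ n ∣ ≡⟨ trans (∣m⊖n∣≡∣n⊖m∣ m n) (∣⊖∣-≤ n≤m) ⟩
    m ℕ.∸ n   ≤⟨ ℕ.m≤n+o⇒m∸n≤o m n m≤2n ⟩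
    n ℕ.+ 0   ≡⟨ ℕ.+-identityʳ n ⟩
    n         ∎
    where open ℕ.≤-Reasoning

  nonnegative-factor : ∀ d .{{_ : ℕ.NonZero d}} i {s} → + d * i ≡ + s →
                       Σ ℕ λ k → i ≡ + k × d ℕ.* k ≡ s
  nonnegative-factor d@(suc _) (+ k)    eq = k , refl , +-injective (trans (pos-* d k) eq)
  nonnegative-factor (suc _)   -[1+ _ ] ()

  private
    twice-remainder : ∀ y d c r →
      + 2 * (y - d * c) ≡ (r - d) + ((+ 2 * y + d) - (r + c * (+ 2 * d)))
    twice-remainder = solve-∀

  nearest-multiple : ∀ y d .{{_ : ℕ.NonZero d}} → Σ ℤ λ c → 2 ℕ.* ∣ y - + d * c ∣ ℕ.≤ d
  nearest-multiple y d@(suc _) = c , (begin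
    2 ℕ.* ∣ y - + d * c ∣    ≡⟨ abs-* (+ 2) (y - + d * c) ⟨
    ∣ + 2 * (y - + d * c) ∣  ≡⟨ cong ∣_∣ twice-error ⟩
    ∣ r ⊖ d ∣                ≤⟨ ∣m⊖n∣≤n (ℕ.<⇒≤ (n%ℕd<d A (2 ℕ.* d))) ⟩
    d                        ∎)
    where
    open ℕ.≤-Reasoning
    A = + 2 * y + + d
    r = A %ℕ (2 ℕ.* d)
    c = A /ℕ (2 ℕ.* d)
    division : A ≡ + r + c * (+ 2 * + d)
    division = trans (a≡a%ℕn+[a/ℕn]*n A (2 ℕ.* d)) (cong (λ t → + r + c * t) (pos-* 2 d))
    twice-error : + 2 * (y - + d * c) ≡ r ⊖ d
    twice-error = trans (twice-remainder y (+ d) c (+ r))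
      (trans (cong (λ t → + r - + d + t) (i≡j⇒i-j≡0 division))
      (trans (+-identityʳ (+ r - + d)) (m-n≡m⊖n r d)))

  private
    error-identity : ∀ n y₁ y₂ c₁ c₂ D →
      (y₁ - D * c₁) * (y₁ - D * c₁) + (y₂ - D * c₂) * (y₂ - D * c₂)
        ≡ D * (n * D - + 2 * (y₁ * c₁ + y₂ * c₂) + D * (c₁ * c₁ + c₂ * c₂))
          + (y₁ * y₁ + y₂ * y₂ - n * (D * D))
    error-identity = solve-∀

    second-intersection-identity : ∀ n y₁ y₂ c₁ c₂ D →
      let d′ = n * D - + 2 * (y₁ * c₁ + y₂ * c₂) + D * (c₁ * c₁ + c₂ * c₂)
          K  = c₁ * c₁ + c₂ * c₂ - n
          z₁ = d′ * c₁ + K * (y₁ - D * c₁)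
          z₂ = d′ * c₂ + K * (y₂ - D * c₂)
      in z₁ * z₁ + z₂ * z₂ ≡ n * (d′ * d′) + K * K * (y₁ * y₁ + y₂ * y₂ - n * (D * D))
    second-intersection-identity = solve-∀

    scaled-sum-of-squares : ∀ D c₁ c₂ →
      D * c₁ * (D * c₁) + D * c₂ * (D * c₂) ≡ D * D * (c₁ * c₁ + c₂ * c₂)
    scaled-sum-of-squares = solve-∀

  -- y / d is a rational point on the circle x₁² + x₂² = n and c a nearest lattice point;
  -- the line through them meets the circle again at z / d′, and 0 ≤ d′ ≤ d / 2.
  module DescentStep (n : ℤ) (d : ℕ) (y₁ y₂ : ℤ) (on-circle : y₁ * y₁ + y₂ * y₂ ≡ n * (+ d * + d))
                     (c₁ c₂ : ℤ) where
    D = + d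
    e₁ = y₁ - D * c₁
    e₂ = y₂ - D * c₂
    d′ = n * D - + 2 * (y₁ * c₁ + y₂ * c₂) + D * (c₁ * c₁ + c₂ * c₂)
    K  = c₁ * c₁ + c₂ * c₂ - n
    z₁ = d′ * c₁ + K * e₁
    z₂ = d′ * c₂ + K * e₂

    defect≡0 : y₁ * y₁ + y₂ * y₂ - n * (D * D) ≡ 0ℤ
    defect≡0 = i≡j⇒i-j≡0 on-circle

    error-norm : e₁ * e₁ + e₂ * e₂ ≡ D * d′
    error-norm = trans (error-identity n y₁ y₂ c₁ c₂ D)
      (trans (cong (_+_ (D * d′)) defect≡0) (+-identityʳ (D * d′)))

    second-intersection : z₁ * z₁ + z₂ * z₂ ≡ n * (d′ * d′)
    second-intersection = trans (second-intersection-identity n y₁ y₂ c₁ c₂ D)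
      (trans (cong (λ t → n * (d′ * d′) + K * K * t) defect≡0)
      (trans (cong (_+_ (n * (d′ * d′))) (*-zeroʳ (K * K))) (+-identityʳ (n * (d′ * d′)))))

    lattice-point : .{{_ : ℕ.NonZero d}} → e₁ ≡ 0ℤ → e₂ ≡ 0ℤ → n ≡ c₁ * c₁ + c₂ * c₂
    lattice-point e₁≡0 e₂≡0 = *-cancelˡ-≡ (D * D) n (c₁ * c₁ + c₂ * c₂) {{i*j≢0 D D}} (begin
      D * D * n                      ≡⟨ *-comm (D * D) n ⟩
      n * (D * D)                    ≡⟨ on-circle ⟨
      y₁ * y₁ + y₂ * y₂
        ≡⟨ cong₂ (λ s t → s * s + t * t) (i-j≡0⇒i≡j y₁ (D * c₁) e₁≡0) (i-j≡0⇒i≡j y₂ (D * c₂) e₂≡0) ⟩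
      D * c₁ * (D * c₁) + D * c₂ * (D * c₂) ≡⟨ scaled-sum-of-squares D c₁ c₂ ⟩
      D * D * (c₁ * c₁ + c₂ * c₂)    ∎)
      where open ≡-Reasoning

  private
    four-times : ∀ d k → 2 ℕ.* d ℕ.* (2 ℕ.* k) ≡ 4 ℕ.* (d ℕ.* k)
    four-times = ℕ-Solver.solve-∀

    doubled-squares : ∀ a₁ a₂ →
      4 ℕ.* (a₁ ℕ.* a₁ ℕ.+ a₂ ℕ.* a₂) ≡ 2 ℕ.* a₁ ℕ.* (2 ℕ.* a₁) ℕ.+ 2 ℕ.* a₂ ℕ.* (2 ℕ.* a₂)
    doubled-squares = ℕ-Solver.solve-∀

    twice-square : ∀ d → d ℕ.* d ℕ.+ d ℕ.* d ≡ 2 ℕ.* d ℕ.* d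
    twice-square = ℕ-Solver.solve-∀

  halving-bound : ∀ {d k a₁ a₂} .{{_ : ℕ.NonZero d}} → 2 ℕ.* a₁ ℕ.≤ d → 2 ℕ.* a₂ ℕ.≤ d →
            d ℕ.* k ≡ a₁ ℕ.* a₁ ℕ.+ a₂ ℕ.* a₂ → 2 ℕ.* k ℕ.≤ d
  halving-bound {d} {k} {a₁} {a₂} 2a₁≤d 2a₂≤d dk≡a² =
    ℕ.*-cancelˡ-≤ (2 ℕ.* d) {{ℕ.m*n≢0 2 d}} (begin
    2 ℕ.* d ℕ.* (2 ℕ.* k)                            ≡⟨ four-times d k ⟩
    4 ℕ.* (d ℕ.* k)                                  ≡⟨ cong (4 ℕ.*_) dk≡a² ⟩
    4 ℕ.* (a₁ ℕ.* a₁ ℕ.+ a₂ ℕ.* a₂)                  ≡⟨ doubled-squares a₁ a₂ ⟩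
    2 ℕ.* a₁ ℕ.* (2 ℕ.* a₁) ℕ.+ 2 ℕ.* a₂ ℕ.* (2 ℕ.* a₂)
      ≤⟨ ℕ.+-mono-≤ (ℕ.*-mono-≤ 2a₁≤d 2a₁≤d) (ℕ.*-mono-≤ 2a₂≤d 2a₂≤d) ⟩
    d ℕ.* d ℕ.+ d ℕ.* d                              ≡⟨ twice-square d ⟩
    2 ℕ.* d ℕ.* d                                    ∎)
    where open ℕ.≤-Reasoning

  descent-step : ∀ n d .{{_ : ℕ.NonZero d}} → SumOfTwoRationalSquares n d →
                 SumOfTwoSquares n ⊎ Σ ℕ λ k → suc k ℕ.< d × SumOfTwoRationalSquares n (suc k)
  descent-step n d (y₁ , y₂ , on-circle) = by-size (nonnegative-factor d d′ error-norm′)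
    where
    c₁ = proj₁ (nearest-multiple y₁ d)
    c₂ = proj₁ (nearest-multiple y₂ d)
    open DescentStep n d y₁ y₂ on-circle c₁ c₂
    a₁ = ∣ e₁ ∣
    a₂ = ∣ e₂ ∣
    error-norm′ : + d * d′ ≡ + (a₁ ℕ.* a₁ ℕ.+ a₂ ℕ.* a₂)
    error-norm′ = begin
      + d * d′                         ≡⟨ error-norm ⟨
      e₁ * e₁ + e₂ * e₂                ≡⟨ cong₂ _+_ (i*i≡∣i∣*∣i∣ e₁) (i*i≡∣i∣*∣i∣ e₂) ⟩
      + (a₁ ℕ.* a₁) + + (a₂ ℕ.* a₂)    ≡⟨ pos-+ (a₁ ℕ.* a₁) (a₂ ℕ.* a₂) ⟨
      + (a₁ ℕ.* a₁ ℕ.+ a₂ ℕ.* a₂)      ∎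
      where open ≡-Reasoning
    by-size : (Σ ℕ λ k → d′ ≡ + k × d ℕ.* k ≡ a₁ ℕ.* a₁ ℕ.+ a₂ ℕ.* a₂) →
              SumOfTwoSquares n ⊎ Σ ℕ λ k → suc k ℕ.< d × SumOfTwoRationalSquares n (suc k)
    by-size (zero , _ , d0≡a²) with m*m+n*n≡0⇒m≡0×n≡0 a₁ a₂ (trans (sym d0≡a²) (ℕ.*-zeroʳ d))
    ... | a₁≡0 , a₂≡0 = inj₁ (c₁ , c₂ , lattice-point (∣i∣≡0⇒i≡0 a₁≡0) (∣i∣≡0⇒i≡0 a₂≡0))
    by-size (suc k , d′≡k , dk≡a²) =
      inj₂ (k , k<d , z₁ , z₂ , subst (λ t → z₁ * z₁ + z₂ * z₂ ≡ n * (t * t)) d′≡k second-intersection)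
      where
      k<d : suc k ℕ.< d
      k<d = ℕ.<-≤-trans (ℕ.m<m+n (suc k) (ℕ.s≤s ℕ.z≤n))
              (halving-bound {d} {suc k} {a₁} {a₂} (proj₂ (nearest-multiple y₁ d))
                             (proj₂ (nearest-multiple y₂ d)) dk≡a²)

  sumOfTwoRationalSquares⇒sumOfTwoSquares : ∀ n d .{{_ : ℕ.NonZero d}} →
                                            SumOfTwoRationalSquares n d → SumOfTwoSquares n
  sumOfTwoRationalSquares⇒sumOfTwoSquares n d = descent d (<-wellFounded d)
    where
    descent : ∀ d .{{_ : ℕ.NonZero d}} → Acc ℕ._<_ d →
              SumOfTwoRationalSquares n d → SumOfTwoSquares n
    descent d (acc smaller) y with descent-step n d y
    ... | inj₁ sum = sum
    ... | inj₂ (k , k<d , z) = descent (suc k) (smaller k<d) z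

open import Data.Nat using (_≤_; _*_)
open import Data.Integer using (-_; _+_) renaming (_*_ to _*ℤ_)
open SumsOfTwoSquares using (sumOfTwoRationalSquares⇒sumOfTwoSquares)

lemma1p3 : (a b c : ℤ) → Irreducible (monicCubic a b c) →
    (z : ℤ) → (q : ℕ) → 1 ≤ q →
    InSumTwoSquares (monicCubic a b c) (const (+ (q * q)) *ₚ (const z +ₚ const (- (+ 1)) *ₚ X)) →
    Σ ℤ λ m → Σ ℤ λ n → eval (monicCubic a b c) z ≡ m *ℤ m + n *ℤ n
lemma1p3 a b c _ z zero      ()
lemma1p3 a b c _ z q@(suc _) _  (w₁ , w₂ , h , sum-mod-p) =
  sumOfTwoRationalSquares⇒sumOfTwoSquares (eval (monicCubic a b c) z) (q * q * q) (r , s , (begin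
    r *ℤ r + s *ℤ s                                                 ≡⟨ norm-sum-of-squares ⟦ w₁ ⟧ ⟦ w₂ ⟧ ⟨
    norm (⟦ w₁ ⟧ ⊠ ⟦ w₁ ⟧ ⊞ ⟦ w₂ ⟧ ⊠ ⟦ w₂ ⟧)
      ≡⟨ cong norm (⟦⟧-mod-p q²[z-x] w₁ w₂ h sum-mod-p) ⟨
    norm ⟦ q²[z-x] ⟧                                                ≡⟨ norm-⟦q²[z-x]⟧ q z ⟩
    eval (monicCubic a b c) z *ℤ (+ (q * q * q) *ℤ + (q * q * q))   ∎))
  where
  open IntegralCubic a b c
  open ≡-Reasoning
  q²[z-x] = const (+ (q * q)) *ₚ (const z +ₚ const (- (+ 1)) *ₚ X)
  r = proj₁ (GaussianCubic.norm (⟦ w₁ ⟧ +i ⟦ w₂ ⟧))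
  s = proj₂ (GaussianCubic.norm (⟦ w₁ ⟧ +i ⟦ w₂ ⟧))
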